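{- Let $H\subseteq\mathbb S$ be an uncountable subgroup and let $F:H\to[\mathbb N]^{<\aleph_0}$ witness that $H$ is strongly almost Abelian. Then there are a perfect set $P\subseteq\mathbb S$ and a finite $W\subseteq\mathbb N$ such that: (i) there is some $g^*\in H$ such that for all $n\in\mathbb N\setminus W$ and all $\pi\in P$, either $\pi(n)=n$ or $\pi(n)=g^*(n)$; (ii) $\mathrm{NC}(\pi,h)\subseteq W\cup F(h)\cup h^{ -1}(W)$ for all $\pi\in P$ and $h\in H$. Moreover, if $H$ is actually Abelian, then $W$ can be taken to be empty, and each $\pi\in P$ commutes with each $h\in H$.
   Context: $\mathbb S$ is the symmetric group of $\mathbb N$, with the topology of pointwise convergence (as a subspace of $\mathbb N^{\mathbb N}$); a perfect set is a nonempty closed set without isolated points. For $\pi,\pi'\in\mathbb S$, $\mathrm{NC}(\pi,\pi')=\{n:\pi(\pi'(n))\ne\pi'(\pi(n))\}$. A subgroup $H\subseteq\mathbb S$ is strongly almost Abelian if there is a function $F$ assigning to each $h\in H$ a finite set $F(h)\subseteq\mathbb N$ such that $\mathrm{NC}(h_1,h_2)\subseteq F(h_1)\cup F(h_2)$ for all $h_1,h_2\in H$; such an $F$ witnesses this. -}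

module Defs where

open import Data.Nat using (ℕ; _<_)
open import Data.List using (List; [])
open import Data.List.Membership.Propositional using (_∈_; _∉_)
open import Data.Product using (Σ; ∃; _×_; _,_)
open import Data.Sum using (_⊎_)
open import Relation.Binary.PropositionalEquality using (_≡_; _≢_; trans; cong)
open import Relation.Nullary using (¬_)

record Perm : Set where
  field
    fun     : ℕ → ℕ
    inv     : ℕ → ℕ
    fun∘inv : ∀ n → fun (inv n) ≡ n
    inv∘fun : ∀ n → inv (fun n) ≡ n
open Perm public

_≈ₚ_ : Perm → Perm → Set
π ≈ₚ σ = ∀ n → fun π n ≡ fun σ n

idP : Perm
idP = record { fun = λ n → n ; inv = λ n → n
             ; fun∘inv = λ _ → Relation.Binary.PropositionalEquality.refl
             ; inv∘fun = λ _ → Relation.Binary.PropositionalEquality.refl }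

_∘P_ : Perm → Perm → Perm
π ∘P σ = record
  { fun = λ n → fun π (fun σ n)
  ; inv = λ n → inv σ (inv π n)
  ; fun∘inv = λ n → trans (cong (fun π) (fun∘inv σ (inv π n))) (fun∘inv π n)
  ; inv∘fun = λ n → trans (cong (inv σ) (inv∘fun π (fun σ n))) (inv∘fun σ n)
  }

_⁻¹P : Perm → Perm
π ⁻¹P = record { fun = inv π ; inv = fun π ; fun∘inv = inv∘fun π ; inv∘fun = fun∘inv π }

PermSet : Set₁
PermSet = Perm → Set

record IsSubgroup (H : PermSet) : Set where
  field
    respects : ∀ {π σ} → π ≈ₚ σ → H π → H σ
    id∈      : H idP
    ∘∈       : ∀ {π σ} → H π → H σ → H (π ∘P σ)
    ⁻¹∈      : ∀ {π} → H π → H (π ⁻¹P)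

Countable : PermSet → Set
Countable H = Σ (ℕ → Perm) λ e → ∀ h → H h → ∃ λ n → e n ≈ₚ h

Uncountable : PermSet → Set
Uncountable H = ¬ Countable H

NC : Perm → Perm → ℕ → Set
NC π σ n = fun π (fun σ n) ≢ fun σ (fun π n)

-- F (finite sets represented as lists) witnesses that H is strongly almost Abelian.
-- (F is given on all of 𝕊; only its values on H matter.)
SAAWitness : PermSet → (Perm → List ℕ) → Set
SAAWitness H F = ∀ h₁ h₂ → H h₁ → H h₂ → ∀ n → NC h₁ h₂ n → n ∈ F h₁ ⊎ n ∈ F h₂

IsAbelian : PermSet → Set
IsAbelian H = ∀ h₁ h₂ → H h₁ → H h₂ → (h₁ ∘P h₂) ≈ₚ (h₂ ∘P h₁)

-- Topology of pointwise convergence: basic neighbourhoods fix values below k.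
AgreeBelow : ℕ → Perm → Perm → Set
AgreeBelow k π σ = ∀ m → m < k → fun π m ≡ fun σ m

IsClosed : PermSet → Set
IsClosed P = ∀ π → (∀ k → ∃ λ σ → P σ × AgreeBelow k σ π) → P π

IsPerfect : PermSet → Set
IsPerfect P =
  (∃ λ π → P π)
  × IsClosed P
  × (∀ π → P π → ∀ k → ∃ λ σ → P σ × AgreeBelow k σ π × ¬ (σ ≈ₚ π))

CondI : PermSet → PermSet → List ℕ → Set
CondI H P W = ∃ λ g → H g × (∀ n → n ∉ W → ∀ π → P π → fun π n ≡ n ⊎ fun π n ≡ fun g n)

CondII : PermSet → (Perm → List ℕ) → PermSet → List ℕ → Set
CondII H F P W = ∀ π h → P π → H h → ∀ n → NC π h n → n ∈ W ⊎ n ∈ F h ⊎ fun h n ∈ W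

-- Call x and h x linked when h ∈ H, x ∉ F h and both points avoid a finite set A.
-- Elements g ∈ H with F g = A commute with these moves, so an agreement between two
-- of them spreads along linked components. If every point moved by g is linked to a
-- point below some K, then g is determined by the finite data (F g, K, g on F g and
-- below K); as H is uncountable, some g ∈ H moves points whose components lie
-- arbitrarily far out. The set of π with π n ∈ {n, g n} that commute with every
-- h ∈ H outside W = F g ∪ g(F g) ∪ g⁻¹(F g) is closed and contains the identity. On a
-- far-out component such a π coincides with the identity or with g, and switching it
-- to the other one there yields a different member agreeing with π on an initial
-- segment, so the set is perfect. For Abelian H the empty witness F gives W = ∅.
module Submission where

open import Defs
open import Level using (0ℓ)
open import Axiom.ExcludedMiddle using (ExcludedMiddle)
open import Axiom.DoubleNegationElimination using (em⇒dne)
open import Data.Bool using (if_then_else_)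
open import Data.Empty using (⊥-elim)
open import Data.List using (List; []; _∷_; map; _++_; upTo)
open import Data.List.Extrema.Nat using (max; xs≤max)
open import Data.List.Membership.Propositional using (_∈_; _∉_)
open import Data.List.Membership.Propositional.Properties using (∈-++⁺ˡ; ∈-++⁺ʳ; ∈-map⁺; ∈-upTo⁺)
open import Data.List.Properties using (∷-injective)
open import Data.List.Relation.Binary.Subset.Propositional using (_⊆_)
open import Data.List.Relation.Unary.All using (lookup)
open import Data.List.Relation.Unary.Any using (here; there)
open import Data.Nat using (ℕ; zero; suc; _≤_; _<_; _⊔_; _≟_; s≤s)
open import Data.Nat.Binary using (ℕᵇ; 2[1+_]; 1+[2_]; fromℕ; toℕ)
open import Data.Nat.Binary.Properties using (fromℕ-toℕ)
open import Data.Nat.Properties using (≤-refl; ≤-trans; <⇒≱; ≮⇒≥; m≤m⊔n; m≤n⊔m)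
open import Data.List.Membership.DecPropositional _≟_ using (_∈?_)
open import Data.Product using (Σ; ∃; _×_; _,_; proj₁; proj₂)
import Data.Product as Product
open import Data.Sum using (_⊎_; inj₁; inj₂; [_,_]′)
open import Function using (_∘_; id; _⇔_; mk⇔; Equivalence)
open import Function.Definitions using (Injective; StrictlySurjective)
import Function.Properties.Equivalence as ⇔
open import Relation.Binary.PropositionalEquality
open import Relation.Nullary using (¬_; Dec; yes; no; does)
open import Relation.Nullary.Decidable using (dec-true; dec-false)
open import Relation.Unary using (Decidable)

fun-injective : (π : Perm) → Injective _≡_ _≡_ (fun π)
fun-injective π {a} {b} e = trans (sym (inv∘fun π a)) (trans (cong (inv π) e) (inv∘fun π b))

map-agree : {A B : Set} {f g : A → B} (xs : List A) → map f xs ≡ map g xs →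
            ∀ {x} → x ∈ xs → f x ≡ g x
map-agree (_ ∷ _)  e (here refl) = proj₁ (∷-injective e)
map-agree (_ ∷ xs) e (there x∈xs) = map-agree xs (proj₂ (∷-injective e)) x∈xs

max<⇒∉ : ∀ xs {x} → max 0 xs < x → x ∉ xs
max<⇒∉ xs max<x x∈xs = <⇒≱ max<x (lookup (xs≤max 0 xs) x∈xs)

choice : {X : Set} {P : X → Set} → X → Dec (∃ P) → X
choice _ (yes (x , _)) = x
choice x₀ (no _) = x₀

choice-satisfies : {X : Set} {P : X → Set} (x₀ : X) (d : Dec (∃ P)) → ∃ P → P (choice x₀ d)
choice-satisfies _ (yes (_ , p)) _ = p
choice-satisfies _ (no ¬∃) ∃P = ⊥-elim (¬∃ ∃P)

Enumeration : Set → Set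
Enumeration A = Σ (ℕ → A) (StrictlySurjective _≡_)

incrHead : List ℕ → List ℕ
incrHead [] = []
incrHead (a ∷ as) = suc a ∷ as

-- Read in bijective base 2, a digit 2[1+_] starts a new entry 0 and a digit 1+[2_]
-- increments the current one.
decodeᵇ : ℕᵇ → List ℕ
decodeᵇ ℕᵇ.zero = []
decodeᵇ 2[1+ x ] = 0 ∷ decodeᵇ x
decodeᵇ 1+[2 x ] = incrHead (decodeᵇ x)

odd-digits : ℕ → ℕᵇ → ℕᵇ
odd-digits zero x = x
odd-digits (suc a) x = 1+[2 odd-digits a x ]

encodeᵇ : List ℕ → ℕᵇ
encodeᵇ [] = ℕᵇ.zero
encodeᵇ (a ∷ as) = odd-digits a 2[1+ encodeᵇ as ]

decodeᵇ-odd-digits : ∀ a x → decodeᵇ (odd-digits a 2[1+ x ]) ≡ a ∷ decodeᵇ x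
decodeᵇ-odd-digits zero x = refl
decodeᵇ-odd-digits (suc a) x = cong incrHead (decodeᵇ-odd-digits a x)

decodeᵇ-encodeᵇ : ∀ as → decodeᵇ (encodeᵇ as) ≡ as
decodeᵇ-encodeᵇ [] = refl
decodeᵇ-encodeᵇ (a ∷ as) =
  trans (decodeᵇ-odd-digits a (encodeᵇ as)) (cong (a ∷_) (decodeᵇ-encodeᵇ as))

ℕ-enumeration : Enumeration ℕ
ℕ-enumeration = id , λ n → n , refl

list-enumeration : Enumeration (List ℕ)
list-enumeration = decodeᵇ ∘ fromℕ , λ as →
  toℕ (encodeᵇ as) , trans (cong decodeᵇ (fromℕ-toℕ (encodeᵇ as))) (decodeᵇ-encodeᵇ as)

firstTwo : List ℕ → ℕ × ℕ
firstTwo (a ∷ b ∷ _) = a , b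
firstTwo _ = 0 , 0

pair-enumeration : Enumeration (ℕ × ℕ)
pair-enumeration = firstTwo ∘ proj₁ list-enumeration , onto
  where
  onto : StrictlySurjective _≡_ (firstTwo ∘ proj₁ list-enumeration)
  onto (a , b) = Product.map₂ (cong firstTwo) (proj₂ list-enumeration (a ∷ b ∷ []))

×-enumeration : {A B : Set} → Enumeration A → Enumeration B → Enumeration (A × B)
×-enumeration (e₁ , onto₁) (e₂ , onto₂) =
  Product.map e₁ e₂ ∘ proj₁ pair-enumeration , λ (a , b) →
    let i , eᵢ = onto₁ a
        j , eⱼ = onto₂ b
        n , eₙ = proj₂ pair-enumeration (i , j)
    in n , trans (cong (Product.map e₁ e₂) eₙ) (cong₂ _,_ eᵢ eⱼ)

data Connected {X : Set} (R : X → X → Set) (r : X) : X → Set where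
  base : Connected R r r
  _▷_  : ∀ {x y} → Connected R r x → R x y → Connected R r y
  _◁_  : ∀ {x y} → Connected R r y → R x y → Connected R r x

connected-transport : {X : Set} {R : X → X → Set} {r : X} (Q : X → Set) →
  (∀ {x y} → Connected R r x → Connected R r y → R x y → Q x ⇔ Q y) →
  ∀ {x} → Connected R r x → Q r ⇔ Q x
connected-transport Q move base = ⇔.refl
connected-transport Q move (c ▷ s) = ⇔.trans (connected-transport Q move c) (move c (c ▷ s) s)
connected-transport Q move (c ◁ s) =
  ⇔.trans (connected-transport Q move c) (⇔.sym (move (c ◁ s) c s))

record Invariant (C : ℕ → Set) (π : Perm) : Set where
  field
    image    : ∀ {x} → C x → C (fun π x)
    preimage : ∀ {x} → C x → C (inv π x)
open Invariant

invariant-if-agrees : ∀ {C π τ} → Invariant C τ → (∀ {x} → C x → fun π x ≡ fun τ x) →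
                      Invariant C π
invariant-if-agrees {C} {π} {τ} invτ agree = record
  { image    = λ c → subst C (sym (agree c)) (image invτ c)
  ; preimage = λ {y} c → subst C (sym (inv-agree c)) (preimage invτ c)
  }
  where
  inv-agree : ∀ {y} → C y → inv π y ≡ inv τ y
  inv-agree {y} c = begin
    inv π y                     ≡⟨ cong (inv π) (sym (fun∘inv τ y)) ⟩
    inv π (fun τ (inv τ y))     ≡⟨ cong (inv π) (sym (agree (preimage invτ c))) ⟩
    inv π (fun π (inv τ y))     ≡⟨ inv∘fun π (inv τ y) ⟩
    inv τ y                     ∎
    where open ≡-Reasoning

module Splice {C : ℕ → Set} (C? : Decidable C) {π τ : Perm}
              (invπ : Invariant C π) (invτ : Invariant C τ) where

  opaque
    patch : (ℕ → ℕ) → (ℕ → ℕ) → ℕ → ℕ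
    patch f g n = if does (C? n) then f n else g n

    patch-inside : ∀ {f g n} → C n → patch f g n ≡ f n
    patch-inside {n = n} c rewrite dec-true (C? n) c = refl

    patch-outside : ∀ {f g n} → ¬ C n → patch f g n ≡ g n
    patch-outside {n = n} ¬c rewrite dec-false (C? n) ¬c = refl

  patch-inverse : ∀ {f f′ g g′} → (∀ n → f (f′ n) ≡ n) → (∀ n → g (g′ n) ≡ n) →
                  (∀ {n} → C n → C (f′ n)) → (∀ {n} → C (g′ n) → C n) →
                  ∀ n → patch f g (patch f′ g′ n) ≡ n
  patch-inverse {f} {f′} {g} {g′} ff′ gg′ f′C g′C n with C? n
  ... | yes c =
    trans (cong (patch f g) (patch-inside c)) (trans (patch-inside (f′C c)) (ff′ n))
  ... | no ¬c =
    trans (cong (patch f g) (patch-outside ¬c)) (trans (patch-outside (¬c ∘ g′C)) (gg′ n))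

  splice : Perm
  splice = record
    { fun = patch (fun τ) (fun π)
    ; inv = patch (inv τ) (inv π)
    ; fun∘inv = patch-inverse (fun∘inv τ) (fun∘inv π) (preimage invτ)
                  (λ {n} c → subst C (fun∘inv π n) (image invπ c))
    ; inv∘fun = patch-inverse (inv∘fun τ) (inv∘fun π) (image invτ)
                  (λ {n} c → subst C (inv∘fun π n) (preimage invπ c))
    }

  splice-inside : ∀ {n} → C n → fun splice n ≡ fun τ n
  splice-inside = patch-inside

  splice-outside : ∀ {n} → ¬ C n → fun splice n ≡ fun π n
  splice-outside = patch-outside

module _ (H : PermSet) (F : Perm → List ℕ) where

  -- For α = fun π this is NC(π, h) ⊆ W ∪ F h ∪ h⁻¹(W), read contrapositively.
  CommutesOutside : (ℕ → ℕ) → List ℕ → Set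
  CommutesOutside α W =
    ∀ {h x} → H h → x ∉ W → fun h x ∉ W → x ∉ F h → α (fun h x) ≡ fun h (α x)

  commutesOutside-mono : ∀ {α W W′} → W ⊆ W′ → CommutesOutside α W → CommutesOutside α W′
  commutesOutside-mono W⊆W′ commutes Hh x∉W′ hx∉W′ =
    commutes Hh (x∉W′ ∘ W⊆W′) (hx∉W′ ∘ W⊆W′)

  commutesOutside⇒NC⊆ : ∀ {π W} → CommutesOutside (fun π) W →
    ∀ {h} → H h → ∀ n → NC π h n → n ∈ W ⊎ n ∈ F h ⊎ fun h n ∈ W
  commutesOutside⇒NC⊆ {W = W} commutes {h} Hh n nc with n ∈? W | n ∈? F h | fun h n ∈? W
  ... | yes n∈W | _         | _          = inj₁ n∈W
  ... | no _    | yes n∈Fh  | _          = inj₂ (inj₁ n∈Fh)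
  ... | no _    | no _      | yes hn∈W   = inj₂ (inj₂ hn∈W)
  ... | no n∉W  | no n∉Fh   | no hn∉W    = ⊥-elim (nc (commutes Hh n∉W hn∉W n∉Fh))

  data Step (A : List ℕ) : ℕ → ℕ → Set where
    step : ∀ {h x} → H h → x ∉ F h → x ∉ A → fun h x ∉ A → Step A x (fun h x)

  Component : List ℕ → ℕ → ℕ → Set
  Component A = Connected (Step A)

  component-avoids : ∀ {A r x} → r ∉ A → Component A r x → x ∉ A
  component-avoids r∉A base = r∉A
  component-avoids _ (_ ▷ step _ _ _ y∉A) = y∉A
  component-avoids _ (_ ◁ step _ _ x∉A _) = x∉A

  agreement-spreads : ∀ {α β W A r} → CommutesOutside α W → CommutesOutside β W →
    (∀ {x} → Component A r x → x ∉ W) →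
    ∀ {x} → Component A r x → α r ≡ β r ⇔ α x ≡ β x
  agreement-spreads {α} {β} {W} {A} {r} commα commβ avoids =
    connected-transport (λ x → α x ≡ β x) move
    where
    move : ∀ {x y} → Component A r x → Component A r y → Step A x y → α x ≡ β x ⇔ α y ≡ β y
    move cx cy (step {h} Hh x∉Fh _ _) =
      mk⇔ (λ e → trans αh (trans (cong (fun h) e) (sym βh)))
          (λ e → fun-injective h (trans (sym αh) (trans e βh)))
      where
      αh = commα Hh (avoids cx) (avoids cy) x∉Fh
      βh = commβ Hh (avoids cx) (avoids cy) x∉Fh

  ReachesBelow : List ℕ → ℕ → ℕ → Set
  ReachesBelow A K r = ∃ λ x → Component A r x × x < K

  Bounded : List ℕ → ℕ → Perm → Set
  Bounded A K g = ∀ r → fun g r ≢ r → r ∉ A → ReachesBelow A K r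

  Unbounded : Perm → Set
  Unbounded g =
    ∀ k → ∃ λ r → fun g r ≢ r × r ∉ F g × (∀ {x} → Component (F g) r x → k ≤ x)

  W-of : Perm → List ℕ
  W-of g = F g ++ map (fun g) (F g) ++ map (inv g) (F g)

  record Admissible (g π : Perm) : Set where
    constructor admissible
    field
      idOrG           : ∀ n → fun π n ≡ n ⊎ fun π n ≡ fun g n
      commutesOutside : CommutesOutside (fun π) (W-of g)
  open Admissible

  idP-admissible : ∀ {g} → Admissible g idP
  idP-admissible = admissible (λ _ → inj₁ refl) λ _ _ _ _ → refl

  admissible-closed : ∀ {g} → IsClosed (Admissible g)
  admissible-closed {g} π near = admissible idOrπ commπ
    where
    idOrπ : ∀ n → fun π n ≡ n ⊎ fun π n ≡ fun g n
    idOrπ n with near (suc n)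
    ... | σ , admσ , agree =
      subst (λ z → z ≡ n ⊎ z ≡ fun g n) (agree n ≤-refl) (idOrG admσ n)
    commπ : CommutesOutside (fun π) (W-of g)
    commπ {h} {x} Hh x∉W hx∉W x∉Fh with near (suc (x ⊔ fun h x))
    ... | σ , admσ , agree = begin
      fun π (fun h x)   ≡⟨ sym (agree (fun h x) (s≤s (m≤n⊔m x (fun h x)))) ⟩
      fun σ (fun h x)   ≡⟨ commutesOutside admσ Hh x∉W hx∉W x∉Fh ⟩
      fun h (fun σ x)   ≡⟨ cong (fun h) (agree x (s≤s (m≤m⊔n x (fun h x)))) ⟩
      fun h (fun π x)   ∎
      where open ≡-Reasoning

  splice-admissible : ∀ {g C} (C? : Decidable C) {π τ}
    (invπ : Invariant C π) (invτ : Invariant C τ) →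
    (∀ {h x} → H h → x ∉ W-of g → fun h x ∉ W-of g → x ∉ F h → C x ⇔ C (fun h x)) →
    Admissible g π → Admissible g τ → Admissible g (Splice.splice C? invπ invτ)
  splice-admissible {g} {C} C? {π} {τ} invπ invτ step-closed
    (admissible idOrπ commπ) (admissible idOrτ commτ) =
    admissible idOrσ commσ
    where
    open Splice C? invπ invτ
    idOrσ : ∀ n → fun splice n ≡ n ⊎ fun splice n ≡ fun g n
    idOrσ n with C? n
    ... | yes c = subst (λ z → z ≡ n ⊎ z ≡ fun g n) (sym (splice-inside c)) (idOrτ n)
    ... | no ¬c = subst (λ z → z ≡ n ⊎ z ≡ fun g n) (sym (splice-outside ¬c)) (idOrπ n)
    commσ : CommutesOutside (fun splice) (W-of g)
    commσ {h} {x} Hh x∉W hx∉W x∉Fh with C? x | step-closed Hh x∉W hx∉W x∉Fh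
    ... | yes c | closed = begin
      fun splice (fun h x)  ≡⟨ splice-inside (Equivalence.to closed c) ⟩
      fun τ (fun h x)       ≡⟨ commτ Hh x∉W hx∉W x∉Fh ⟩
      fun h (fun τ x)       ≡⟨ cong (fun h) (sym (splice-inside c)) ⟩
      fun h (fun splice x)  ∎
      where open ≡-Reasoning
    ... | no ¬c | closed = begin
      fun splice (fun h x)  ≡⟨ splice-outside (¬c ∘ Equivalence.from closed) ⟩
      fun π (fun h x)       ≡⟨ commπ Hh x∉W hx∉W x∉Fh ⟩
      fun h (fun π x)       ≡⟨ cong (fun h) (sym (splice-outside ¬c)) ⟩
      fun h (fun splice x)  ∎
      where open ≡-Reasoning

  bounded-unless-unbounded : ExcludedMiddle 0ℓ → ∀ {g} → ¬ Unbounded g →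
                             ∃ λ K → Bounded (F g) K g
  bounded-unless-unbounded em ¬u = dne λ ¬b → ¬u λ k → dne λ ¬r →
    ¬b (k , λ r moved r∉ → dne λ ¬reach →
      ¬r (r , moved , r∉ , λ {x} c → ≮⇒≥ λ x<k → ¬reach (_ , c , x<k)))
    where
    dne : {P : Set} → ¬ ¬ P → P
    dne = em⇒dne em

  module FarComponent (em : ExcludedMiddle 0ℓ) {g} (Hg : H g) {r : ℕ}
                      (avoids : ∀ {x} → Component (F g) r x → x ∉ W-of g) where

    C : ℕ → Set
    C = Component (F g) r

    F⊆W : F g ⊆ W-of g
    F⊆W = ∈-++⁺ˡ

    step-closed : ∀ {h x} → H h → x ∉ W-of g → fun h x ∉ W-of g → x ∉ F h → C x ⇔ C (fun h x)
    step-closed {h} {x} Hh x∉W hx∉W x∉Fh = mk⇔ (_▷ s) (_◁ s)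
      where
      s : Step (F g) x (fun h x)
      s = step Hh x∉Fh (x∉W ∘ F⊆W) (hx∉W ∘ F⊆W)

    g-invariant : Invariant C g
    g-invariant = record { image = gC ; preimage = g⁻¹C }
      where
      gC : ∀ {x} → C x → C (fun g x)
      gC {x} c = c ▷ step Hg (avoids c ∘ F⊆W) (avoids c ∘ F⊆W) gx∉F
        where
        gx∉F : fun g x ∉ F g
        gx∉F i = avoids c (∈-++⁺ʳ (F g) (∈-++⁺ʳ (map (fun g) (F g))
                   (subst (_∈ map (inv g) (F g)) (inv∘fun g x) (∈-map⁺ (inv g) i))))
      g⁻¹C : ∀ {y} → C y → C (inv g y)
      g⁻¹C {y} c = subst C (sym (fun∘inv g y)) c ◁ step Hg g⁻¹y∉F g⁻¹y∉F gg⁻¹y∉F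
        where
        g⁻¹y∉F : inv g y ∉ F g
        g⁻¹y∉F i = avoids c (∈-++⁺ʳ (F g) (∈-++⁺ˡ
                     (subst (_∈ map (fun g) (F g)) (fun∘inv g y) (∈-map⁺ (fun g) i))))
        gg⁻¹y∉F : fun g (inv g y) ∉ F g
        gg⁻¹y∉F = subst (_∉ F g) (sym (fun∘inv g y)) (avoids c ∘ F⊆W)

    idP-invariant : Invariant C idP
    idP-invariant = record { image = id ; preimage = id }

    switch : ∀ {π τ₀ τ₁} → Admissible g π → Admissible g τ₀ → Admissible g τ₁ →
      Invariant C τ₀ → Invariant C τ₁ → fun π r ≡ fun τ₀ r → fun τ₁ r ≢ fun τ₀ r →
      ∃ λ σ → Admissible g σ × (∀ {n} → ¬ C n → fun σ n ≡ fun π n) × ¬ (σ ≈ₚ π)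
    switch {π} {τ₀} {τ₁} admπ adm₀ adm₁ inv₀ inv₁ πr≡τ₀r τ₁r≢τ₀r =
      splice , splice-admissible C? invπ inv₁ step-closed admπ adm₁ , splice-outside ,
      λ σ≈π → τ₁r≢τ₀r (trans (sym (splice-inside base)) (trans (σ≈π r) πr≡τ₀r))
      where
      C? : Decidable C
      C? _ = em
      π-agrees : ∀ {x} → C x → fun π x ≡ fun τ₀ x
      π-agrees c = Equivalence.to
        (agreement-spreads (commutesOutside admπ) (commutesOutside adm₀) avoids c) πr≡τ₀r
      invπ : Invariant C π
      invπ = invariant-if-agrees inv₀ π-agrees
      open Splice C? invπ inv₁

  module _ (saa : SAAWitness H F) where

    H-commutesOutside : ∀ {g} → H g → CommutesOutside (fun g) (F g)
    H-commutesOutside {g} Hg {h} {x} Hh x∉Fg _ x∉Fh with fun g (fun h x) ≟ fun h (fun g x)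
    ... | yes e = e
    ... | no ne = ⊥-elim ([ x∉Fg , x∉Fh ]′ (saa g h Hg Hh x ne))

    self-admissible : ∀ {g} → H g → Admissible g g
    self-admissible Hg =
      admissible (λ _ → inj₂ refl) (commutesOutside-mono ∈-++⁺ˡ (H-commutesOutside Hg))

    agree-where-reached : ∀ {g₁ g₂ A K m} → H g₁ → H g₂ → F g₁ ≡ A → F g₂ ≡ A →
      (∀ {n} → n < K → fun g₁ n ≡ fun g₂ n) → m ∉ A → ReachesBelow A K m → fun g₁ m ≡ fun g₂ m
    agree-where-reached {g₁} {g₂} H₁ H₂ refl e₂ agree m∉A (x , c , x<K) =
      Equivalence.from
        (agreement-spreads (H-commutesOutside H₁)
                           (subst (CommutesOutside (fun g₂)) e₂ (H-commutesOutside H₂))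
                           (component-avoids m∉A) c)
        (agree x<K)

    determined : ∀ {g₁ g₂ A K} → H g₁ → H g₂ → F g₁ ≡ A → F g₂ ≡ A →
      Bounded A K g₁ → Bounded A K g₂ →
      (∀ {n} → n ∈ A → fun g₁ n ≡ fun g₂ n) → (∀ {n} → n < K → fun g₁ n ≡ fun g₂ n) →
      g₁ ≈ₚ g₂
    determined {g₁} {g₂} {A} H₁ H₂ e₁ e₂ bounded₁ bounded₂ agree∈ agree< n
      with n ∈? A | fun g₁ n ≟ n | fun g₂ n ≟ n
    ... | yes n∈A | _        | _        = agree∈ n∈A
    ... | no n∉A  | no moved | _        =
      agree-where-reached H₁ H₂ e₁ e₂ agree< n∉A (bounded₁ n moved n∉A)
    ... | no n∉A  | yes _    | no moved =
      agree-where-reached H₁ H₂ e₁ e₂ agree< n∉A (bounded₂ n moved n∉A)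
    ... | no _    | yes fix₁ | yes fix₂ = trans fix₁ (sym fix₂)

    Code : Set
    Code = List ℕ × ℕ × List ℕ

    code-enumeration : Enumeration Code
    code-enumeration =
      ×-enumeration list-enumeration (×-enumeration ℕ-enumeration list-enumeration)

    HasCode : Code → Perm → Set
    HasCode (A , K , B) h = H h × F h ≡ A × map (fun h) (A ++ upTo K) ≡ B × Bounded A K h

    bounded-enumeration : ExcludedMiddle 0ℓ →
      Σ (ℕ → Perm) λ e → ∀ {h K} → H h → Bounded (F h) K h → ∃ λ n → e n ≈ₚ h
    bounded-enumeration em = chosen ∘ proj₁ code-enumeration , cover
      where
      chosen : Code → Perm
      chosen c = choice idP (em {∃ (HasCode c)})
      cover : ∀ {h K} → H h → Bounded (F h) K h → ∃ λ n → chosen (proj₁ code-enumeration n) ≈ₚ h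
      cover {h} {K} Hh bounded = n , subst (λ c′ → chosen c′ ≈ₚ h) (sym eₙ) chosen≈h
        where
        c : Code
        c = F h , K , map (fun h) (F h ++ upTo K)
        n : ℕ
        n = proj₁ (proj₂ code-enumeration c)
        eₙ : proj₁ code-enumeration n ≡ c
        eₙ = proj₂ (proj₂ code-enumeration c)
        chosen≈h : chosen c ≈ₚ h
        chosen≈h with choice-satisfies idP (em {∃ (HasCode c)}) (h , Hh , refl , refl , bounded)
        ... | Hc , eF , eMap , bounded′ =
          determined Hc Hh eF refl bounded′ bounded
            (agree ∘ ∈-++⁺ˡ) (agree ∘ ∈-++⁺ʳ (F h) ∘ ∈-upTo⁺)
          where
          agree : ∀ {x} → x ∈ F h ++ upTo K → fun (chosen c) x ≡ fun h x
          agree = map-agree (F h ++ upTo K) eMap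

    -- Unfolding this classical proof term in later with-abstractions exhausts memory.
    opaque
      unbounded-exists : ExcludedMiddle 0ℓ → Uncountable H → ∃ λ g → H g × Unbounded g
      unbounded-exists em uncountable = em⇒dne em λ ¬∃ → uncountable
        (enumerate , λ h Hh → cover Hh (proj₂ (bounded-unless-unbounded em λ u → ¬∃ (h , Hh , u))))
        where
        enumerate : ℕ → Perm
        enumerate = proj₁ (bounded-enumeration em)
        cover : ∀ {h K} → H h → Bounded (F h) K h → ∃ λ n → enumerate n ≈ₚ h
        cover = proj₂ (bounded-enumeration em)

    no-isolated-points : ExcludedMiddle 0ℓ → ∀ {g} → H g → Unbounded g →
      ∀ π → Admissible g π → ∀ k → ∃ λ σ → Admissible g σ × AgreeBelow k σ π × ¬ (σ ≈ₚ π)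
    no-isolated-points em {g} Hg unbounded π admπ k
      with unbounded (k ⊔ suc (max 0 (W-of g)))
    ... | r , moved , _ , far = toAgreeBelow switched
      where
      open FarComponent em Hg (λ c → max<⇒∉ (W-of g) (≤-trans (m≤n⊔m k _) (far c)))
      switched : ∃ λ σ → Admissible g σ × (∀ {n} → ¬ C n → fun σ n ≡ fun π n) × ¬ (σ ≈ₚ π)
      switched with idOrG admπ r
      ... | inj₁ πr≡r = switch admπ idP-admissible (self-admissible Hg)
                          idP-invariant g-invariant πr≡r moved
      ... | inj₂ πr≡gr = switch admπ (self-admissible Hg) idP-admissible
                           g-invariant idP-invariant πr≡gr (moved ∘ sym)
      toAgreeBelow : (∃ λ σ → Admissible g σ × (∀ {n} → ¬ C n → fun σ n ≡ fun π n) × ¬ (σ ≈ₚ π)) →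
                     ∃ λ σ → Admissible g σ × AgreeBelow k σ π × ¬ (σ ≈ₚ π)
      toAgreeBelow (σ , admσ , outside , σ≉π) =
        σ , admσ , (λ m m<k → outside λ c → <⇒≱ m<k (≤-trans (m≤m⊔n k _) (far c))) , σ≉π

    admissible-properties : ExcludedMiddle 0ℓ → ∀ {g} → H g → Unbounded g →
      IsPerfect (Admissible g) × CondI H (Admissible g) (W-of g)
        × CondII H F (Admissible g) (W-of g)
    admissible-properties em {g} Hg unbounded =
      ((idP , idP-admissible) , admissible-closed , no-isolated-points em Hg unbounded) ,
      (g , Hg , λ n _ π admπ → idOrG admπ n) ,
      (λ π h admπ Hh → commutesOutside⇒NC⊆ {π} {W-of g} (commutesOutside admπ) Hh)

    perfect-set : ExcludedMiddle 0ℓ → Uncountable H →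
      ∃ λ g → IsPerfect (Admissible g) × CondI H (Admissible g) (W-of g)
                × CondII H F (Admissible g) (W-of g)
    perfect-set em uncountable with unbounded-exists em uncountable
    ... | g , Hg , unbounded = g , admissible-properties em Hg unbounded

abelian-SAAWitness : ∀ {H} → IsAbelian H → SAAWitness H (λ _ → [])
abelian-SAAWitness commutative h₁ h₂ H₁ H₂ n nc = ⊥-elim (nc (commutative h₁ h₂ H₁ H₂ n))

abelian-perfect-set : ExcludedMiddle 0ℓ → ∀ {H} → Uncountable H → IsAbelian H →
  let P = Admissible H (λ _ → []) in
  ∃ λ g → IsPerfect (P g) × CondI H (P g) [] × (∀ π h → P g π → H h → (π ∘P h) ≈ₚ (h ∘P π))
abelian-perfect-set em {H} uncountable commutative
  with perfect-set H (λ _ → []) (abelian-SAAWitness commutative) em uncountable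
... | g , perfect , condI , _ =
  g , perfect , condI , λ π h admπ Hh _ → Admissible.commutesOutside admπ Hh (λ ()) (λ ()) (λ ())

lemma3p4 : ExcludedMiddle 0ℓ →
    (H : PermSet) → IsSubgroup H → Uncountable H →
    (F : Perm → List ℕ) → SAAWitness H F →
    (Σ PermSet λ P → Σ (List ℕ) λ W → IsPerfect P × CondI H P W × CondII H F P W)
    × (IsAbelian H →
        Σ PermSet λ P → IsPerfect P × CondI H P [] × CondII H F P []
          × (∀ π h → P π → H h → (π ∘P h) ≈ₚ (h ∘P π)))
-- H need not be a subgroup: only the witness F is used.
lemma3p4 em H _ uncountable F saa = general , abelian
  where
  general : Σ PermSet λ P → Σ (List ℕ) λ W → IsPerfect P × CondI H P W × CondII H F P W
  general with perfect-set H F saa em uncountable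
  ... | g , properties = Admissible H F g , W-of H F g , properties

  abelian : IsAbelian H →
    Σ PermSet λ P → IsPerfect P × CondI H P [] × CondII H F P []
      × (∀ π h → P π → H h → (π ∘P h) ≈ₚ (h ∘P π))
  abelian commutative with abelian-perfect-set em uncountable commutative
  ... | g , perfect , condI , commutes =
    Admissible H (λ _ → []) g , perfect , condI ,
    (λ π h admπ Hh n nc → ⊥-elim (nc (commutes π h admπ Hh n))) , commutes
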